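{- Every $\sim$-equivalence class of balanced words contains a unique reduced word, and this reduced word is the minimal word of the equivalence class with respect to alphabetical order.
   Context: Let $\mathcal{A}$ be the free associative $\mathbb{C}$-algebra on two generators $L$ and $R$ (letters). A word is a finite product of letters (possibly empty). A word is balanced if $L$ and $R$ occur in it equally many times. Let $S=\{FG-GF\colon F,G \text{ nonempty balanced words}\}$, let $\mathcal{J}$ be the two-sided ideal generated by $S$, and for words $X,Y$ write $X\sim Y$ if $X-Y\in\mathcal{J}$ (equivalence classes of words are finite). Words are linearly ordered alphabetically (lexicographically with $L$ before $R$, and a proper prefix coming before any extension of it; e.g. $LL<LLR$, $LLL<LR$). A word is prime if it is nonempty, balanced, and not a product of two nonempty balanced words. For a word $W=a_1\cdots a_n$ and $0\le k\le n$, $e_k(W)=\sum_{i=1}^k\overline{a_i}$ with $\overline{R}=1$, $\overline{L}=-1$. A prime $P$ of length $l(P)$ is an upper prime if $e_k(P)>0$ for $1\le k\le l(P)-1$, and a lower prime if $e_k(P)<0$ for $1\le k\le l(P)-1$. A word is reduced if it contains no subword (consecutive block of letters) of the form $UD$ with $U$ an upper prime and $D$ a lower prime. -}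

module Defs where

open import Level using (Level; _⊔_)
open import Data.Nat using (ℕ; zero; suc; _∸_)
open import Data.Integer as ℤ using (ℤ; +_; -[1+_]; 0ℤ)
open import Data.List using (List; []; _∷_; _++_; length; take; concatMap; filter)
open import Data.List.Relation.Unary.All using (All)
open import Data.Product using (Σ; ∃; _×_; _,_)
open import Relation.Nullary using (¬_; Dec; yes; no)
open import Relation.Binary.PropositionalEquality using (_≡_; _≢_; refl)
open import Algebra.Bundles using (CommutativeRing)

data Letter : Set where
  L R : Letter

Word : Set
Word = List Letter

_≟ᴸ_ : (a b : Letter) → Dec (a ≡ b)
L ≟ᴸ L = yes refl
L ≟ᴸ R = no (λ ())
R ≟ᴸ L = no (λ ())
R ≟ᴸ R = yes refl

_≟ᵂ_ : (u v : Word) → Dec (u ≡ v)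
[] ≟ᵂ [] = yes refl
[] ≟ᵂ (_ ∷ _) = no (λ ())
(_ ∷ _) ≟ᵂ [] = no (λ ())
(a ∷ u) ≟ᵂ (b ∷ v) with a ≟ᴸ b | u ≟ᵂ v
... | yes refl | yes refl = yes refl
... | no a≢b | _ = no (λ { refl → a≢b refl })
... | yes _ | no u≢v = no (λ { refl → u≢v refl })

count : Letter → Word → ℕ
count a [] = 0
count a (b ∷ w) with a ≟ᴸ b
... | yes _ = suc (count a w)
... | no _ = count a w

NonEmpty : Word → Set
NonEmpty w = w ≢ []

Balanced : Word → Set
Balanced w = count L w ≡ count R w

data _≤ᵃ_ : Word → Word → Set where
  []≤   : ∀ {w} → [] ≤ᵃ w
  L<R   : ∀ {u v} → (L ∷ u) ≤ᵃ (R ∷ v)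
  cons≤ : ∀ {a u v} → u ≤ᵃ v → (a ∷ u) ≤ᵃ (a ∷ v)

Prime : Word → Set
Prime P = NonEmpty P × Balanced P ×
  ¬ (Σ Word λ U → Σ Word λ V →
       NonEmpty U × Balanced U × NonEmpty V × Balanced V × P ≡ U ++ V)

val : Letter → ℤ
val R = + 1
val L = -[1+ 0 ]

e : Word → ℤ
e [] = 0ℤ
e (a ∷ w) = val a ℤ.+ e w

eₖ : ℕ → Word → ℤ
eₖ k W = e (take k W)

UpperPrime : Word → Set
UpperPrime P = Prime P ×
  (∀ k → 1 Data.Nat.≤ k → k Data.Nat.≤ length P ∸ 1 → 0ℤ ℤ.< eₖ k P)

LowerPrime : Word → Set
LowerPrime P = Prime P ×
  (∀ k → 1 Data.Nat.≤ k → k Data.Nat.≤ length P ∸ 1 → eₖ k P ℤ.< 0ℤ)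

Reduced : Word → Set
Reduced W = ¬ (Σ Word λ A → Σ Word λ U → Σ Word λ D → Σ Word λ B →
  UpperPrime U × LowerPrime D × W ≡ A ++ U ++ D ++ B)

record Field (c ℓ : Level) : Set (Level.suc (c ⊔ ℓ)) where
  field
    commRing : CommutativeRing c ℓ
  open CommutativeRing commRing public
  field
    1≉0     : ¬ (1# ≈ 0#)
    inverse : ∀ x → ¬ (x ≈ 0#) → Σ Carrier λ y → x * y ≈ 1#

-- The free associative K-algebra on {L, R}: its elements are finite
-- K-linear combinations of words, represented as lists of
-- (coefficient, word) pairs; two such lists denote the same element
-- iff every word has the same (summed) coefficient in both.

module FreeAlgebra {c ℓ : Level} (K : Field c ℓ) where
  open Field K

  Elem : Set c
  Elem = List (Carrier × Word)

  coeff : Word → Elem → Carrier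
  coeff w [] = 0#
  coeff w ((x , u) ∷ xs) with u ≟ᵂ w
  ... | yes _ = x + coeff w xs
  ... | no _  = coeff w xs

  _≋_ : Elem → Elem → Set ℓ
  f ≋ g = ∀ w → coeff w f ≈ coeff w g

  diff : Word → Word → Elem
  diff X Y = (1# , X) ∷ (- 1# , Y) ∷ []

  -- a term c · A (F G - G F) B of the ideal J generated by S,
  -- given as (c , A , F , G , B)
  Term : Set c
  Term = Carrier × Word × Word × Word × Word

  ValidTerm : Term → Set
  ValidTerm (_ , _ , F , G , _) =
    NonEmpty F × Balanced F × NonEmpty G × Balanced G

  expand : Term → Elem
  expand (x , A , F , G , B) =
    (x , A ++ F ++ G ++ B) ∷ (- x , A ++ G ++ F ++ B) ∷ []

  InJ : Elem → Set (c ⊔ ℓ)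
  InJ f = Σ (List Term) λ ts → All ValidTerm ts × (f ≋ concatMap expand ts)

  _∼_ : Word → Word → Set (c ⊔ ℓ)
  X ∼ Y = InJ (diff X Y)

module Submission where

-- Read a word as a lattice path, R a step up and L a step down.  Replacing a factor UD, with U an
-- upper and D a lower prime, by DU is a move allowed by J and makes the word alphabetically smaller,
-- so repeating it ends in a reduced word nf W ∼ W.  Swapping adjacent balanced factors does not
-- change the step profile of a word: how many R's and how many L's are read at each height.  A
-- reduced word lies alphabetically below every word with the same profile (where the two first
-- differ, an R in the reduced word against an L in the other would force an upper prime of the
-- reduced word to be followed by a lower one).  So nf is constant on the generators of J, the
-- functional summing the coefficients of the words with a given normal form vanishes on J, and it
-- would be 1 on X - W if nf X ≠ nf W.

open import Defs
open import Level using (Level)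
open import Algebra.Bundles using (AbelianGroup)
import Algebra.Properties.CommutativeSemigroup as CommSemigroupProperties
import Algebra.Properties.Group as GroupProperties
open import Data.Nat as ℕ using (ℕ; zero; suc; _∸_; z≤n; s≤s; _+_; _*_; _^_; _≤_; _<_)
import Data.Nat.Properties as ℕP
open import Data.Integer as ℤ using (ℤ; 0ℤ; 1ℤ; -1ℤ; pred)
  renaming (suc to sucℤ; _+_ to _+ℤ_; _≤_ to _≤ℤ_; _<_ to _<ℤ_)
import Data.Integer.Properties as ℤP
open import Data.List using (List; []; _∷_; _++_; length; take; concatMap)
open import Data.List.Properties
  using (++-assoc; length-++; length-++-sucʳ; length-++-≤ˡ; length-++-≤ʳ; take-all; take-[]; concatMap-++; ++-identityʳ)
open import Data.Product using (Σ; _×_; _,_; proj₁; proj₂)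
open import Data.Sum using (_⊎_; inj₁; inj₂)
open import Data.Empty using (⊥-elim)
open import Relation.Nullary using (¬_; Dec; yes; no; ¬?)
open import Relation.Nullary.Decidable using (map′; _×-dec_; _⊎-dec_; _→-dec_)
open import Data.List.Relation.Unary.All using (All; []; _∷_)
import Data.List.Relation.Unary.All.Properties as AllP
open import Function using (_∘_)
open import Relation.Binary.PropositionalEquality

private
  module ℤ+ = CommSemigroupProperties ℤP.+-commutativeSemigroup
  module ℕ+ = CommSemigroupProperties ℕP.+-commutativeSemigroup
  module ℤ+G = GroupProperties (AbelianGroup.group ℤP.+-0-abelianGroup)

e-++ : ∀ u w → e (u ++ w) ≡ e u +ℤ e w
e-++ [] w = sym (ℤP.+-identityˡ (e w))
e-++ (a ∷ u) w = trans (cong (val a +ℤ_) (e-++ u w)) (sym (ℤP.+-assoc (val a) (e u) (e w)))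

e+count-L≡count-R : ∀ w → e w +ℤ ℤ.+ count L w ≡ ℤ.+ count R w
e+count-L≡count-R [] = refl
e+count-L≡count-R (L ∷ w) = trans (ℤ+.xy∙z≈y∙xz -1ℤ (e w) (ℤ.+ suc (count L w))) (e+count-L≡count-R w)
e+count-L≡count-R (R ∷ w) = trans (ℤP.+-assoc 1ℤ (e w) _) (cong sucℤ (e+count-L≡count-R w))

balanced⇒e≡0 : ∀ w → Balanced w → e w ≡ 0ℤ
balanced⇒e≡0 w bal = ℤ+G.identityˡ-unique (e w) (ℤ.+ count L w)
  (trans (e+count-L≡count-R w) (cong ℤ.+_ (sym bal)))

e≡0⇒balanced : ∀ w → e w ≡ 0ℤ → Balanced w
e≡0⇒balanced w e≡0 = ℤP.+-injective (begin
  ℤ.+ count L w            ≡⟨ ℤP.+-identityˡ _ ⟨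
  0ℤ +ℤ ℤ.+ count L w      ≡⟨ cong (_+ℤ ℤ.+ count L w) e≡0 ⟨
  e w +ℤ ℤ.+ count L w     ≡⟨ e+count-L≡count-R w ⟩
  ℤ.+ count R w            ∎)
  where open ≡-Reasoning

i≤j+i⇒0≤j : ∀ i j → i ≤ℤ j +ℤ i → 0ℤ ≤ℤ j
i≤j+i⇒0≤j i j le = subst₂ _≤ℤ_ (ℤP.+-inverseʳ i) (ℤ+G.//-rightDividesʳ i j) (ℤP.+-monoˡ-≤ (ℤ.- i) le)

j+i≤i⇒j≤0 : ∀ i j → j +ℤ i ≤ℤ i → j ≤ℤ 0ℤ
j+i≤i⇒j≤0 i j le = subst₂ _≤ℤ_ (ℤ+G.//-rightDividesʳ i j) (ℤP.+-inverseʳ i) (ℤP.+-monoˡ-≤ (ℤ.- i) le)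

i<suc[i] : ∀ i → i <ℤ sucℤ i
i<suc[i] i = ℤP.suc[i]≤j⇒i<j ℤP.≤-refl

pred[i]<i : ∀ i → pred i <ℤ i
pred[i]<i i = subst (pred i <ℤ_) (ℤP.suc-pred i) (i<suc[i] (pred i))

take-++-≤ : ∀ {A : Set} k (u v : List A) → k ≤ length u → take k (u ++ v) ≡ take k u
take-++-≤ zero u v _ = refl
take-++-≤ (suc k) (a ∷ u) v (s≤s k≤u) = cong (a ∷_) (take-++-≤ k u v k≤u)

take-length-++ : ∀ {A : Set} (u v : List A) → take (length u) (u ++ v) ≡ u
take-length-++ u v = trans (take-++-≤ (length u) u v ℕP.≤-refl) (take-all (length u) u ℕP.≤-refl)

inner-heights≢0⇒prime : ∀ P → NonEmpty P → Balanced P →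
  (∀ k → 1 ≤ k → k ≤ length P ∸ 1 → eₖ k P ≢ 0ℤ) → Prime P
inner-heights≢0⇒prime P ne bal ≢0 = ne , bal , λ where
  ([] , _ , neU , _) → neU refl
  (_ , [] , _ , _ , neV , _) → neV refl
  (a ∷ U , b ∷ V , _ , balU , _ , _ , refl) →
    ≢0 (length (a ∷ U)) (s≤s z≤n)
       (subst (length (a ∷ U) ≤_) (cong (_∸ 1) (sym (length-++-sucʳ (a ∷ U) b V))) (length-++-≤ˡ (a ∷ U)))
       (trans (cong e (take-length-++ (a ∷ U) (b ∷ V))) (balanced⇒e≡0 (a ∷ U) balU))

NeverBelow : ℤ → ℤ → Word → Set
NeverBelow j c [] = j ≤ℤ c
NeverBelow j c (a ∷ w) = j ≤ℤ c × NeverBelow j (val a +ℤ c) w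

NeverAbove : ℤ → ℤ → Word → Set
NeverAbove j c [] = c ≤ℤ j
NeverAbove j c (a ∷ w) = c ≤ℤ j × NeverAbove j (val a +ℤ c) w

neverBelow-take : ∀ {j c} M → NeverBelow j c M → ∀ k → j ≤ℤ eₖ k M +ℤ c
neverBelow-take {j} {c} [] j≤c k rewrite take-[] {A = Letter} k = subst (j ≤ℤ_) (sym (ℤP.+-identityˡ c)) j≤c
neverBelow-take {j} {c} (a ∷ M) (j≤c , _) zero = subst (j ≤ℤ_) (sym (ℤP.+-identityˡ c)) j≤c
neverBelow-take {j} {c} (a ∷ M) (_ , nb) (suc k) =
  subst (j ≤ℤ_) (sym (ℤ+.xy∙z≈y∙xz (val a) (eₖ k M) c)) (neverBelow-take M nb k)

neverAbove-take : ∀ {j c} M → NeverAbove j c M → ∀ k → eₖ k M +ℤ c ≤ℤ j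
neverAbove-take {j} {c} [] c≤j k rewrite take-[] {A = Letter} k = subst (_≤ℤ j) (sym (ℤP.+-identityˡ c)) c≤j
neverAbove-take {j} {c} (a ∷ M) (c≤j , _) zero = subst (_≤ℤ j) (sym (ℤP.+-identityˡ c)) c≤j
neverAbove-take {j} {c} (a ∷ M) (_ , na) (suc k) =
  subst (_≤ℤ j) (sym (ℤ+.xy∙z≈y∙xz (val a) (eₖ k M) c)) (neverAbove-take M na k)

suc-k≤length-∷ʳ : ∀ {k} (M : Word) a → suc k ≤ length (M ++ a ∷ []) → k ≤ length M
suc-k≤length-∷ʳ M a le = ℕP.≤-pred (subst (_ ≤_) (trans (length-++ M) (ℕP.+-comm (length M) 1)) le)

upperPrime-bracket : ∀ {h} M → NeverBelow h h M → e M +ℤ h ≡ h → UpperPrime (R ∷ M ++ L ∷ [])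
upperPrime-bracket {h} M nb end =
  inner-heights≢0⇒prime _ (λ ()) bal (λ k 1≤k k≤ → ℤP.<⇒≢ (pos k 1≤k k≤) ∘ sym) , pos
  where
  e≡0 : e M ≡ 0ℤ
  e≡0 = ℤ+G.identityˡ-unique (e M) h end
  bal : Balanced (R ∷ M ++ L ∷ [])
  bal = e≡0⇒balanced (R ∷ M ++ L ∷ []) (cong (1ℤ +ℤ_) (trans (e-++ M (L ∷ [])) (cong (_+ℤ -1ℤ) e≡0)))
  pos : ∀ k → 1 ≤ k → k ≤ length (R ∷ M ++ L ∷ []) ∸ 1 → 0ℤ <ℤ eₖ k (R ∷ M ++ L ∷ [])
  pos (suc k) _ le rewrite take-++-≤ k M (L ∷ []) (suc-k≤length-∷ʳ M L le) =
    ℤP.suc[i]≤j⇒i<j (ℤP.suc-mono (i≤j+i⇒0≤j h (eₖ k M) (neverBelow-take M nb k)))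

lowerPrime-bracket : ∀ {h} M → NeverAbove h h M → e M +ℤ h ≡ h → LowerPrime (L ∷ M ++ R ∷ [])
lowerPrime-bracket {h} M na end =
  inner-heights≢0⇒prime _ (λ ()) bal (λ k 1≤k k≤ → ℤP.<⇒≢ (neg k 1≤k k≤)) , neg
  where
  e≡0 : e M ≡ 0ℤ
  e≡0 = ℤ+G.identityˡ-unique (e M) h end
  bal : Balanced (L ∷ M ++ R ∷ [])
  bal = e≡0⇒balanced (L ∷ M ++ R ∷ []) (cong (-1ℤ +ℤ_) (trans (e-++ M (R ∷ [])) (cong (_+ℤ 1ℤ) e≡0)))
  neg : ∀ k → 1 ≤ k → k ≤ length (L ∷ M ++ R ∷ []) ∸ 1 → eₖ k (L ∷ M ++ R ∷ []) <ℤ 0ℤ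
  neg (suc k) _ le rewrite take-++-≤ k M (R ∷ []) (suc-k≤length-∷ʳ M R le) =
    ℤP.i≤pred[j]⇒i<j (ℤP.pred-mono (j+i≤i⇒j≤0 h (eₖ k M) (neverAbove-take M na k)))

upperPrime-head : ∀ {U} → UpperPrime U → Σ Word λ U′ → U ≡ R ∷ U′
upperPrime-head {[]} ((ne , _) , _) = ⊥-elim (ne refl)
upperPrime-head {R ∷ U} _ = U , refl
upperPrime-head {L ∷ []} ((_ , () , _) , _)
upperPrime-head {L ∷ _ ∷ _} (_ , pos) with pos 1 (s≤s z≤n) (s≤s z≤n)
... | ()

lowerPrime-head : ∀ {D} → LowerPrime D → Σ Word λ D′ → D ≡ L ∷ D′
lowerPrime-head {[]} ((ne , _) , _) = ⊥-elim (ne refl)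
lowerPrime-head {L ∷ D} _ = D , refl
lowerPrime-head {R ∷ []} ((_ , () , _) , _)
lowerPrime-head {R ∷ _ ∷ _} (_ , neg) with neg 1 (s≤s z≤n) (s≤s z≤n)
... | ℤ.+<+ ()

allInner? : ∀ {P : ℕ → Set} → (∀ k → Dec (P k)) → ∀ n → Dec (∀ k → 1 ≤ k → k ≤ n → P k)
allInner? P? n = map′ (λ f k 1≤k k≤n → f (s≤s k≤n) 1≤k) (λ g {k} k<1+n 1≤k → g k 1≤k (ℕP.≤-pred k<1+n))
  (ℕP.allUpTo? (λ k → (1 ℕ.≤? k) →-dec P? k) (suc n))

upperPrime? : ∀ U → Dec (UpperPrime U)
upperPrime? U = map′
  (λ (ne , bal , pos) → inner-heights≢0⇒prime U ne bal (λ k 1≤k k≤ → ℤP.<⇒≢ (pos k 1≤k k≤) ∘ sym) , pos)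
  (λ ((ne , bal , _) , pos) → ne , bal , pos)
  (¬? (U ≟ᵂ []) ×-dec (count L U ℕ.≟ count R U) ×-dec allInner? (λ k → 0ℤ ℤ.<? eₖ k U) (length U ∸ 1))

lowerPrime? : ∀ D → Dec (LowerPrime D)
lowerPrime? D = map′
  (λ (ne , bal , neg) → inner-heights≢0⇒prime D ne bal (λ k 1≤k k≤ → ℤP.<⇒≢ (neg k 1≤k k≤)) , neg)
  (λ ((ne , bal , _) , neg) → ne , bal , neg)
  (¬? (D ≟ᵂ []) ×-dec (count L D ℕ.≟ count R D) ×-dec allInner? (λ k → eₖ k D ℤ.<? 0ℤ) (length D ∸ 1))

Split : (Word → Word → Set) → Word → Set
Split P w = Σ Word λ u → Σ Word λ v → w ≡ u ++ v × P u v

split? : ∀ {P} → (∀ u v → Dec (P u v)) → ∀ w → Dec (Split P w)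
split? P? [] = map′ (λ p → [] , [] , refl , p) (λ { ([] , _ , refl , p) → p }) (P? [] [])
split? {P} P? (a ∷ w) = map′ to from (P? [] (a ∷ w) ⊎-dec split? (λ u → P? (a ∷ u)) w)
  where
  to : P [] (a ∷ w) ⊎ Split (λ u → P (a ∷ u)) w → Split P (a ∷ w)
  to (inj₁ p) = [] , a ∷ w , refl , p
  to (inj₂ (u , v , refl , p)) = a ∷ u , v , refl , p
  from : Split P (a ∷ w) → P [] (a ∷ w) ⊎ Split (λ u → P (a ∷ u)) w
  from ([] , _ , refl , p) = inj₁ p
  from (_ ∷ u , v , refl , p) = inj₂ (u , v , refl , p)

UDFactorisation : Word → Set
UDFactorisation w = Σ Word λ A → Σ Word λ U → Σ Word λ D → Σ Word λ B →
  UpperPrime U × LowerPrime D × w ≡ A ++ U ++ D ++ B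

UDFactorisation? : ∀ w → Dec (UDFactorisation w)
UDFactorisation? w = map′
  (λ { (A , _ , refl , U , _ , refl , up , D , B , refl , lp) → A , U , D , B , up , lp , refl })
  (λ { (A , U , D , B , up , lp , refl) → A , U ++ D ++ B , refl , U , D ++ B , refl , up , D , B , refl , lp })
  (split? (λ _ → split? (λ U N → upperPrime? U ×-dec split? (λ D _ → lowerPrime? D) N)) w)

bit : Letter → ℕ
bit L = 0
bit R = 1

binary : Word → ℕ
binary [] = 0
binary (a ∷ w) = bit a * 2 ^ length w + binary w

binary<2^length : ∀ w → binary w < 2 ^ length w
binary<2^length [] = s≤s z≤n
binary<2^length (a ∷ w) = ℕP.<-≤-trans
  (ℕP.+-mono-≤-< (ℕP.*-monoˡ-≤ (2 ^ length w) (bit≤1 a)) (binary<2^length w))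
  (ℕP.≤-reflexive (ℕP.+-comm (2 ^ length w + 0) (2 ^ length w)))
  where
  bit≤1 : ∀ a → bit a ≤ 1
  bit≤1 L = z≤n
  bit≤1 R = s≤s z≤n

binary-L∷<R∷ : ∀ s t → length s ≡ length t → binary (L ∷ s) < binary (R ∷ t)
binary-L∷<R∷ s t s≡t = ℕP.<-≤-trans (binary<2^length s)
  (subst (λ n → 2 ^ n ≤ (2 ^ length t + 0) + binary t) (sym s≡t)
    (ℕP.≤-trans (ℕP.m≤m+n (2 ^ length t) 0) (ℕP.m≤m+n _ (binary t))))

binary-++-<ʳ : ∀ A s t → length s ≡ length t → binary s < binary t → binary (A ++ s) < binary (A ++ t)
binary-++-<ʳ [] s t _ lt = lt
binary-++-<ʳ (a ∷ A) s t s≡t lt rewrite length-++ A {s} | length-++ A {t} | s≡t =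
  ℕP.+-monoʳ-< (bit a * 2 ^ (length A + length t)) (binary-++-<ʳ A s t s≡t lt)

length-swap : ∀ (D U B : Word) → length (D ++ U ++ B) ≡ length (U ++ D ++ B)
length-swap D U B = begin
  length (D ++ U ++ B)               ≡⟨ length-++ D ⟩
  length D + length (U ++ B)         ≡⟨ cong (length D +_) (length-++ U) ⟩
  length D + (length U + length B)   ≡⟨ ℕ+.x∙yz≈y∙xz (length D) (length U) (length B) ⟩
  length U + (length D + length B)   ≡⟨ cong (length U +_) (length-++ D) ⟨
  length U + length (D ++ B)         ≡⟨ length-++ U ⟨
  length (U ++ D ++ B)               ∎
  where open ≡-Reasoning

binary-DU<UD : ∀ A {U D} B → UpperPrime U → LowerPrime D → binary (A ++ D ++ U ++ B) < binary (A ++ U ++ D ++ B)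
binary-DU<UD A B up lp with upperPrime-head up | lowerPrime-head lp
... | U , refl | D , refl = binary-++-<ʳ A _ _ (length-swap (L ∷ D) (R ∷ U) B)
  (binary-L∷<R∷ (D ++ R ∷ U ++ B) (U ++ L ∷ D ++ B) (ℕP.suc-injective (length-swap (L ∷ D) (R ∷ U) B)))

normalise : ℕ → Word → Word
normalise zero w = w
normalise (suc n) w with UDFactorisation? w
... | no _ = w
... | yes (A , U , D , B , _) = normalise n (A ++ D ++ U ++ B)

normalise-reduced : ∀ n w → binary w < n → Reduced (normalise n w)
normalise-reduced (suc n) w lt with UDFactorisation? w
... | no reduced = reduced
... | yes (A , U , D , B , up , lp , refl) =
  normalise-reduced n _ (ℕP.<-≤-trans (binary-DU<UD A B up lp) (ℕP.≤-pred lt))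

nf : Word → Word
nf w = normalise (suc (binary w)) w

nf-reduced : ∀ w → Reduced (nf w)
nf-reduced w = normalise-reduced (suc (binary w)) w ℕP.≤-refl

reduced⇒nf≡ : ∀ w → Reduced w → nf w ≡ w
reduced⇒nf≡ w reduced with UDFactorisation? w
... | no _ = refl
... | yes ud = ⊥-elim (reduced ud)

δ : ℤ → ℤ → ℕ
δ i j with i ℤ.≟ j
... | yes _ = 1
... | no _ = 0

δ-refl : ∀ i → δ i i ≡ 1
δ-refl i with i ℤ.≟ i
... | yes _ = refl
... | no i≢i = ⊥-elim (i≢i refl)

δ-≢ : ∀ {i j} → i ≢ j → δ i j ≡ 0
δ-≢ {i} {j} i≢j with i ℤ.≟ j
... | yes i≡j = ⊥-elim (i≢j i≡j)
... | no _ = refl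

stepAt : Letter → Letter → ℤ → ℤ → ℕ
stepAt L L = δ
stepAt R R = δ
stepAt _ _ _ _ = 0

stepAt-≢ : ∀ a b {i j} → i ≢ j → stepAt a b i j ≡ 0
stepAt-≢ L L = δ-≢
stepAt-≢ R R = δ-≢
stepAt-≢ L R _ = refl
stepAt-≢ R L _ = refl

-- steps a h w k: the number of letters a in w read at height k, when w is read from height h.
steps : Letter → ℤ → Word → ℤ → ℕ
steps a h [] k = 0
steps a h (b ∷ w) k = stepAt a b h k + steps a (val b +ℤ h) w k

steps-here : ∀ a h w → 1 ≤ steps a h (a ∷ w) h
steps-here L h w rewrite δ-refl h = s≤s z≤n
steps-here R h w rewrite δ-refl h = s≤s z≤n

steps-++ : ∀ a h u w k → steps a h (u ++ w) k ≡ steps a h u k + steps a (e u +ℤ h) w k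
steps-++ a h [] w k = cong (λ c → steps a c w k) (sym (ℤP.+-identityˡ h))
steps-++ a h (b ∷ u) w k = begin
  stepAt a b h k + steps a (val b +ℤ h) (u ++ w) k
    ≡⟨ cong (stepAt a b h k +_) (steps-++ a (val b +ℤ h) u w k) ⟩
  stepAt a b h k + (steps a (val b +ℤ h) u k + steps a (e u +ℤ (val b +ℤ h)) w k)
    ≡⟨ cong (λ c → stepAt a b h k + (steps a (val b +ℤ h) u k + steps a c w k)) (ℤ+.xy∙z≈y∙xz (val b) (e u) h) ⟨
  stepAt a b h k + (steps a (val b +ℤ h) u k + steps a (e (b ∷ u) +ℤ h) w k)
    ≡⟨ ℕP.+-assoc (stepAt a b h k) _ _ ⟨
  steps a h (b ∷ u) k + steps a (e (b ∷ u) +ℤ h) w k ∎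
  where open ≡-Reasoning

steps-++-balanced : ∀ a h u w k → e u ≡ 0ℤ → steps a h (u ++ w) k ≡ steps a h u k + steps a h w k
steps-++-balanced a h u w k e≡0 = trans (steps-++ a h u w k)
  (cong (λ c → steps a h u k + steps a c w k) (trans (cong (_+ℤ h) e≡0) (ℤP.+-identityˡ h)))

SameSteps : ℤ → Word → Word → Set
SameSteps h v x = ∀ a k → steps a h v k ≡ steps a h x k

sameSteps-swap : ∀ h A F G B → e F ≡ 0ℤ → e G ≡ 0ℤ → SameSteps h (A ++ F ++ G ++ B) (A ++ G ++ F ++ B)
sameSteps-swap h A F G B eF eG a k = begin
  steps a h (A ++ F ++ G ++ B) k              ≡⟨ steps-++ a h A _ k ⟩
  steps a h A k + steps a h′ (F ++ G ++ B) k  ≡⟨ cong (steps a h A k +_) (split F G eF eG) ⟩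
  steps a h A k + (s F + (s G + s B))         ≡⟨ cong (steps a h A k +_) (ℕ+.x∙yz≈y∙xz (s F) (s G) (s B)) ⟩
  steps a h A k + (s G + (s F + s B))         ≡⟨ cong (steps a h A k +_) (split G F eG eF) ⟨
  steps a h A k + steps a h′ (G ++ F ++ B) k  ≡⟨ steps-++ a h A _ k ⟨
  steps a h (A ++ G ++ F ++ B) k              ∎
  where
  open ≡-Reasoning
  h′ : ℤ
  h′ = e A +ℤ h
  s : Word → ℕ
  s w = steps a h′ w k
  split : ∀ X Y → e X ≡ 0ℤ → e Y ≡ 0ℤ → s (X ++ Y ++ B) ≡ s X + (s Y + s B)
  split X Y eX eY = trans (steps-++-balanced a h′ X _ k eX) (cong (s X +_) (steps-++-balanced a h′ Y B k eY))

sameSteps-∷⁻ : ∀ h a v x → SameSteps h (a ∷ v) (a ∷ x) → SameSteps (val a +ℤ h) v x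
sameSteps-∷⁻ h a v x same b k = ℕP.+-cancelˡ-≡ (stepAt b a h k) _ _ (same b k)

normalise-sameSteps : ∀ n w h → SameSteps h (normalise n w) w
normalise-sameSteps zero w h a k = refl
normalise-sameSteps (suc n) w h with UDFactorisation? w
... | no _ = λ a k → refl
... | yes (A , U , D , B , ((_ , balU , _) , _) , ((_ , balD , _) , _) , refl) = λ a k →
  trans (normalise-sameSteps n _ h a k)
        (sameSteps-swap h A D U B (balanced⇒e≡0 D balD) (balanced⇒e≡0 U balU) a k)

first-L-step : ∀ w {c h} → h ≤ℤ c → 1 ≤ steps L c w h →
  Σ Word λ Q → Σ Word λ r → w ≡ Q ++ L ∷ r × NeverBelow h c Q × e Q +ℤ c ≡ h
first-L-step (L ∷ w) {c} {h} h≤c hasL with c ℤ.≟ h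
... | yes refl = [] , w , refl , ℤP.≤-refl , ℤP.+-identityˡ c
... | no c≢h with first-L-step w (ℤP.i<j⇒i≤pred[j] (ℤP.≤∧≢⇒< h≤c (c≢h ∘ sym))) hasL
...   | Q , r , refl , nb , end = L ∷ Q , r , refl , (h≤c , nb) , trans (ℤ+.xy∙z≈y∙xz -1ℤ (e Q) c) end
first-L-step (R ∷ w) {c} h≤c hasL with first-L-step w (ℤP.≤-trans h≤c (ℤP.i≤suc[i] c)) hasL
... | Q , r , refl , nb , end = R ∷ Q , r , refl , (h≤c , nb) , trans (ℤ+.xy∙z≈y∙xz 1ℤ (e Q) c) end

first-R-step : ∀ w {c h} → c ≤ℤ h → 1 ≤ steps R c w h →
  Σ Word λ Q → Σ Word λ r → w ≡ Q ++ R ∷ r × NeverAbove h c Q × e Q +ℤ c ≡ h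
first-R-step (R ∷ w) {c} {h} c≤h hasR with c ℤ.≟ h
... | yes refl = [] , w , refl , ℤP.≤-refl , ℤP.+-identityˡ c
... | no c≢h with first-R-step w (ℤP.i<j⇒suc[i]≤j (ℤP.≤∧≢⇒< c≤h c≢h)) hasR
...   | Q , r , refl , na , end = R ∷ Q , r , refl , (c≤h , na) , trans (ℤ+.xy∙z≈y∙xz 1ℤ (e Q) c) end
first-R-step (L ∷ w) {c} c≤h hasR with first-R-step w (ℤP.i≤j⇒pred[i]≤j c≤h) hasR
... | Q , r , refl , na , end = L ∷ Q , r , refl , (c≤h , na) , trans (ℤ+.xy∙z≈y∙xz -1ℤ (e Q) c) end

L-step-above : ∀ w {c j} → sucℤ j ≤ℤ c → 1 ≤ steps L c w j → 1 ≤ steps L c w (sucℤ j)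
L-step-above (R ∷ w) {c} j<c hasL = L-step-above w (ℤP.≤-trans j<c (ℤP.i≤suc[i] c)) hasL
L-step-above (L ∷ w) {c} {j} j<c hasL with c ℤ.≟ sucℤ j
... | yes refl = s≤s z≤n
... | no c≢j+1 = L-step-above w (ℤP.i<j⇒i≤pred[j] (ℤP.≤∧≢⇒< j<c (c≢j+1 ∘ sym)))
  (subst (λ n → 1 ≤ n + steps L (pred c) w j) (δ-≢ (ℤP.<⇒≢ (ℤP.<-≤-trans (i<suc[i] j) j<c) ∘ sym)) hasL)

R-step-below : ∀ w {c j} → c ≤ℤ j → 1 ≤ steps R c w (sucℤ j) → 1 ≤ steps R c w j
R-step-below (L ∷ w) c≤j hasR = R-step-below w (ℤP.i≤j⇒pred[i]≤j c≤j) hasR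
R-step-below (R ∷ w) {c} {j} c≤j hasR with c ℤ.≟ j
... | yes refl = s≤s z≤n
... | no c≢j = R-step-below w (ℤP.i<j⇒suc[i]≤j (ℤP.≤∧≢⇒< c≤j c≢j))
  (subst (λ n → 1 ≤ n + steps R (sucℤ c) w (sucℤ j)) (δ-≢ (ℤP.<⇒≢ (ℤP.≤-<-trans c≤j (i<suc[i] j)))) hasR)

steps-below-floor : ∀ a M {c j j′} → NeverBelow j c M → j′ <ℤ j → steps a c M j′ ≡ 0
steps-below-floor a [] _ _ = refl
steps-below-floor a (b ∷ M) {c} (j≤c , nb) j′<j
  rewrite stepAt-≢ a b (ℤP.<⇒≢ (ℤP.<-≤-trans j′<j j≤c) ∘ sym) = steps-below-floor a M nb j′<j

reduced-suffix : ∀ P {v} → Reduced (P ++ v) → Reduced v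
reduced-suffix P reduced (A , U , D , B , up , lp , refl) =
  reduced (P ++ A , U , D , B , up , lp , sym (++-assoc P A _))

no-R-step-after-upperPrime : ∀ {P} r h → UpperPrime P → Reduced (P ++ L ∷ r) → steps R (pred h) r (pred h) ≡ 0
no-R-step-after-upperPrime {P} r h up reduced with steps R (pred h) r (pred h) in hasR
... | zero = refl
... | suc _ with first-R-step r ℤP.≤-refl (subst (1 ≤_) (sym hasR) (s≤s z≤n))
...   | M , r′ , refl , na , end = ⊥-elim (reduced
  ([] , P , L ∷ M ++ R ∷ [] , r′ , up , lowerPrime-bracket M na end ,
   cong (λ w → P ++ L ∷ w) (sym (++-assoc M (R ∷ []) r′))))

-- The path R v first comes back down to height h + 1 by closing an upper prime P = R M L.  As P
-- cannot be followed by a lower prime, after P the path either restarts with R (induction) or steps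
-- down with L and never climbs back up from h - 1.
no-R-step-under-L-step : ∀ n v h → length v < n → Reduced (R ∷ v) →
  1 ≤ steps L h (R ∷ v) h → steps R h (R ∷ v) (pred h) ≡ 0
no-R-step-under-L-step (suc n) v h v<1+n reduced hasL
  with first-L-step v ℤP.≤-refl (L-step-above v ℤP.≤-refl hasL)
... | M , v₂ , refl , nb , end = begin
  steps R h (R ∷ M ++ L ∷ v₂) (pred h)          ≡⟨ split R (pred h) ⟩
  steps R h P (pred h) + steps R h v₂ (pred h)  ≡⟨ cong₂ _+_ no-R-in-P (rest v₂ reduced-P++v₂ hasL₂ v₂≤n) ⟩
  0                                             ∎
  where
  open ≡-Reasoning
  P : Word
  P = R ∷ M ++ L ∷ []
  up : UpperPrime P
  up = upperPrime-bracket M nb end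
  P++v₂ : R ∷ M ++ L ∷ v₂ ≡ P ++ v₂
  P++v₂ = cong (R ∷_) (sym (++-assoc M (L ∷ []) v₂))
  reduced-P++v₂ : Reduced (P ++ v₂)
  reduced-P++v₂ = subst Reduced P++v₂ reduced
  split : ∀ a k → steps a h (R ∷ M ++ L ∷ v₂) k ≡ steps a h P k + steps a h v₂ k
  split a k = trans (cong (λ w → steps a h w k) P++v₂)
    (steps-++-balanced a h P v₂ k (balanced⇒e≡0 P (proj₁ (proj₂ (proj₁ up)))))
  no-L-in-P : steps L h P h ≡ 0
  no-L-in-P rewrite steps-++ L (sucℤ h) M (L ∷ []) h | end | steps-below-floor L M nb (i<suc[i] h)
    | δ-≢ (ℤP.<⇒≢ (i<suc[i] h) ∘ sym) = refl
  no-R-in-P : steps R h P (pred h) ≡ 0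
  no-R-in-P rewrite steps-++ R (sucℤ h) M (L ∷ []) (pred h)
    | steps-below-floor R M nb (ℤP.<-trans (pred[i]<i h) (i<suc[i] h)) | δ-≢ (ℤP.<⇒≢ (pred[i]<i h) ∘ sym) = refl
  hasL₂ : 1 ≤ steps L h v₂ h
  hasL₂ = subst (1 ≤_) (trans (split L h) (cong (_+ steps L h v₂ h) no-L-in-P)) hasL
  v₂≤n : length v₂ ≤ n
  v₂≤n = ℕP.≤-trans (ℕP.n≤1+n _) (ℕP.≤-trans (length-++-≤ʳ (L ∷ v₂) {M}) (ℕP.≤-pred v<1+n))
  rest : ∀ w → Reduced (P ++ w) → 1 ≤ steps L h w h → length w ≤ n → steps R h w (pred h) ≡ 0
  rest (R ∷ v₃) red hasL′ v₃<n = no-R-step-under-L-step n v₃ h v₃<n (reduced-suffix P red) hasL′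
  rest (L ∷ r) red _ _ = no-R-step-after-upperPrime r h up red

reduced-R∷-¬sameSteps-L∷ : ∀ h v x → Reduced (R ∷ v) → ¬ SameSteps h (R ∷ v) (L ∷ x)
reduced-R∷-¬sameSteps-L∷ h v x reduced same = ℕP.n≮0 (subst (1 ≤_) no-R-in-x R-in-x)
  where
  no-R-in-x : steps R (pred h) x (pred h) ≡ 0
  no-R-in-x = trans (sym (same R (pred h)))
    (no-R-step-under-L-step (suc (length v)) v h ℕP.≤-refl reduced (subst (1 ≤_) (sym (same L h)) (steps-here L h x)))
  R-in-x : 1 ≤ steps R (pred h) x (pred h)
  R-in-x = R-step-below x ℤP.≤-refl
    (subst (λ k → 1 ≤ steps R (pred h) x k) (sym (ℤP.suc-pred h)) (subst (1 ≤_) (same R h) (steps-here R h v)))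

reduced⇒≤ᵃ : ∀ h v x → Reduced v → SameSteps h v x → v ≤ᵃ x
reduced⇒≤ᵃ h [] x _ _ = []≤
reduced⇒≤ᵃ h (a ∷ v) [] _ same = ⊥-elim (ℕP.n≮0 (subst (1 ≤_) (same a h) (steps-here a h v)))
reduced⇒≤ᵃ h (L ∷ v) (R ∷ x) _ _ = L<R
reduced⇒≤ᵃ h (R ∷ v) (L ∷ x) reduced same = ⊥-elim (reduced-R∷-¬sameSteps-L∷ h v x reduced same)
reduced⇒≤ᵃ h (L ∷ v) (L ∷ x) reduced same =
  cons≤ (reduced⇒≤ᵃ (val L +ℤ h) v x (reduced-suffix (L ∷ []) reduced) (sameSteps-∷⁻ h L v x same))
reduced⇒≤ᵃ h (R ∷ v) (R ∷ x) reduced same =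
  cons≤ (reduced⇒≤ᵃ (val R +ℤ h) v x (reduced-suffix (R ∷ []) reduced) (sameSteps-∷⁻ h R v x same))

≤ᵃ-antisym : ∀ {u v} → u ≤ᵃ v → v ≤ᵃ u → u ≡ v
≤ᵃ-antisym []≤ []≤ = refl
≤ᵃ-antisym (cons≤ u≤v) (cons≤ v≤u) = cong (_ ∷_) (≤ᵃ-antisym u≤v v≤u)

reduced-unique : ∀ h {v x} → Reduced v → Reduced x → SameSteps h v x → v ≡ x
reduced-unique h {v} {x} rv rx same =
  ≤ᵃ-antisym (reduced⇒≤ᵃ h v x rv same) (reduced⇒≤ᵃ h x v rx (λ a k → sym (same a k)))

nf-sameSteps : ∀ h w → SameSteps h (nf w) w
nf-sameSteps h w = normalise-sameSteps (suc (binary w)) w h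

nf-≤ᵃ : ∀ w → nf w ≤ᵃ w
nf-≤ᵃ w = reduced⇒≤ᵃ 0ℤ (nf w) w (nf-reduced w) (nf-sameSteps 0ℤ w)

nf-swap : ∀ A F G B → Balanced F → Balanced G → nf (A ++ F ++ G ++ B) ≡ nf (A ++ G ++ F ++ B)
nf-swap A F G B balF balG = reduced-unique 0ℤ (nf-reduced FG) (nf-reduced GF) λ a k →
  trans (nf-sameSteps 0ℤ FG a k) (trans (sameSteps-swap 0ℤ A F G B (balanced⇒e≡0 F balF) (balanced⇒e≡0 G balG) a k)
    (sym (nf-sameSteps 0ℤ GF a k)))
  where
  FG GF : Word
  FG = A ++ F ++ G ++ B
  GF = A ++ G ++ F ++ B

module _ {c ℓ : Level} (K : Field c ℓ) where
  open FreeAlgebra K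
  private
    module K = Field K
    module K+G = GroupProperties K.+-group
    module K+S = CommSemigroupProperties K.+-commutativeSemigroup
  open K using (Carrier; 0#; 1#; _≈_) renaming (_+_ to _+ᴷ_; -_ to -ᴷ_)
  open import Relation.Binary.Reasoning.Setoid K.setoid

  coeff-++ : ∀ w f g → coeff w (f ++ g) ≈ coeff w f +ᴷ coeff w g
  coeff-++ w [] g = K.sym (K.+-identityˡ _)
  coeff-++ w ((x , u) ∷ f) g with u ≟ᵂ w
  ... | yes _ = K.trans (K.+-congˡ (coeff-++ w f g)) (K.sym (K.+-assoc x _ _))
  ... | no _ = coeff-++ w f g

  coeff-neg : ∀ w Y → coeff w ((-ᴷ 1# , Y) ∷ []) ≈ -ᴷ coeff w ((1# , Y) ∷ [])
  coeff-neg w Y with Y ≟ᵂ w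
  ... | yes _ = K.trans (K.+-identityʳ _) (K.-‿cong (K.sym (K.+-identityʳ 1#)))
  ... | no _ = K.sym K+G.ε⁻¹≈ε

  coeff-diff : ∀ w X Y → coeff w (diff X Y) ≈ coeff w ((1# , X) ∷ []) +ᴷ -ᴷ coeff w ((1# , Y) ∷ [])
  coeff-diff w X Y = K.trans (coeff-++ w ((1# , X) ∷ []) ((-ᴷ 1# , Y) ∷ [])) (K.+-congˡ (coeff-neg w Y))

  ∼-refl : ∀ X → X ∼ X
  ∼-refl X = [] , [] , λ w → K.trans (coeff-diff w X X) (K.-‿inverseʳ _)

  ∼-trans : ∀ {X Y Z} → X ∼ Y → Y ∼ Z → X ∼ Z
  ∼-trans {X} {Y} {Z} (ts , valid-ts , X-Y≋ts) (us , valid-us , Y-Z≋us) =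
    ts ++ us , AllP.++⁺ valid-ts valid-us , λ w → begin
      coeff w (diff X Z)                                   ≈⟨ coeff-diff w X Z ⟩
      x w +ᴷ -ᴷ z w                                        ≈⟨ K.+-congʳ (K+G.//-rightDividesˡ (y w) (x w)) ⟨
      ((x w +ᴷ -ᴷ y w) +ᴷ y w) +ᴷ -ᴷ z w                   ≈⟨ K.+-assoc _ (y w) (-ᴷ z w) ⟩
      (x w +ᴷ -ᴷ y w) +ᴷ (y w +ᴷ -ᴷ z w)                   ≈⟨ K.+-cong (coeff-diff w X Y) (coeff-diff w Y Z) ⟨
      coeff w (diff X Y) +ᴷ coeff w (diff Y Z)             ≈⟨ K.+-cong (X-Y≋ts w) (Y-Z≋us w) ⟩
      coeff w (concatMap expand ts) +ᴷ coeff w (concatMap expand us) ≈⟨ coeff-++ w (concatMap expand ts) _ ⟨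
      coeff w (concatMap expand ts ++ concatMap expand us) ≡⟨ cong (coeff w) (concatMap-++ expand ts us) ⟨
      coeff w (concatMap expand (ts ++ us))                ∎
    where
    x y z : Word → Carrier
    x w = coeff w ((1# , X) ∷ [])
    y w = coeff w ((1# , Y) ∷ [])
    z w = coeff w ((1# , Z) ∷ [])

  ∼-swap : ∀ A {F G} B → NonEmpty F → Balanced F → NonEmpty G → Balanced G →
    (A ++ F ++ G ++ B) ∼ (A ++ G ++ F ++ B)
  ∼-swap A {F} {G} B neF balF neG balG = (1# , A , F , G , B) ∷ [] , (neF , balF , neG , balG) ∷ [] ,
    λ w → K.reflexive (cong (coeff w) (sym (++-identityʳ (expand (1# , A , F , G , B)))))

  normalise-∼ : ∀ n w → normalise n w ∼ w
  normalise-∼ zero w = ∼-refl w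
  normalise-∼ (suc n) w with UDFactorisation? w
  ... | no _ = ∼-refl w
  ... | yes (A , U , D , B , ((neU , balU , _) , _) , ((neD , balD , _) , _) , refl) =
    ∼-trans {normalise n (A ++ D ++ U ++ B)} {A ++ D ++ U ++ B} {A ++ U ++ D ++ B}
      (normalise-∼ n (A ++ D ++ U ++ B)) (∼-swap A B neD balD neU balU)

  inClass : Word → Word → Carrier → Carrier
  inClass V u x with nf u ≟ᵂ V
  ... | yes _ = x
  ... | no _ = 0#

  inClass-cong : ∀ V u {x y} → x ≈ y → inClass V u x ≈ inClass V u y
  inClass-cong V u x≈y with nf u ≟ᵂ V
  ... | yes _ = x≈y
  ... | no _ = K.refl

  inClass-0# : ∀ V u → inClass V u 0# ≈ 0#
  inClass-0# V u with nf u ≟ᵂ V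
  ... | yes _ = K.refl
  ... | no _ = K.refl

  inClass-+ : ∀ V u x y → inClass V u (x +ᴷ y) ≈ inClass V u x +ᴷ inClass V u y
  inClass-+ V u x y with nf u ≟ᵂ V
  ... | yes _ = K.refl
  ... | no _ = K.sym (K.+-identityʳ 0#)

  classCoeff : Word → Elem → Carrier
  classCoeff V [] = 0#
  classCoeff V ((x , u) ∷ f) = inClass V u x +ᴷ classCoeff V f

  classCoeff-++ : ∀ V f g → classCoeff V (f ++ g) ≈ classCoeff V f +ᴷ classCoeff V g
  classCoeff-++ V [] g = K.sym (K.+-identityˡ _)
  classCoeff-++ V ((x , u) ∷ f) g =
    K.trans (K.+-congˡ (classCoeff-++ V f g)) (K.sym (K.+-assoc (inClass V u x) _ _))

  removeWord : Word → Elem → Elem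
  removeWord u [] = []
  removeWord u ((x , w) ∷ f) with w ≟ᵂ u
  ... | yes _ = removeWord u f
  ... | no _ = (x , w) ∷ removeWord u f

  classCoeff-removeWord : ∀ V u f → classCoeff V f ≈ inClass V u (coeff u f) +ᴷ classCoeff V (removeWord u f)
  classCoeff-removeWord V u [] = K.sym (K.trans (K.+-congʳ (inClass-0# V u)) (K.+-identityʳ 0#))
  classCoeff-removeWord V u ((x , w) ∷ f) with w ≟ᵂ u
  ... | yes refl = begin
    inClass V u x +ᴷ classCoeff V f                                    ≈⟨ K.+-congˡ (classCoeff-removeWord V u f) ⟩
    inClass V u x +ᴷ (inClass V u (coeff u f) +ᴷ classCoeff V (removeWord u f)) ≈⟨ K.+-assoc _ _ _ ⟨
    (inClass V u x +ᴷ inClass V u (coeff u f)) +ᴷ classCoeff V (removeWord u f) ≈⟨ K.+-congʳ (inClass-+ V u x _) ⟨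
    inClass V u (x +ᴷ coeff u f) +ᴷ classCoeff V (removeWord u f)      ∎
  ... | no _ = K.trans (K.+-congˡ (classCoeff-removeWord V u f)) (K+S.x∙yz≈y∙xz (inClass V w x) _ _)

  coeff-removeWord-self : ∀ u f → coeff u (removeWord u f) ≈ 0#
  coeff-removeWord-self u [] = K.refl
  coeff-removeWord-self u ((x , w) ∷ f) with w ≟ᵂ u
  ... | yes _ = coeff-removeWord-self u f
  ... | no w≢u with w ≟ᵂ u
  ...   | yes w≡u = ⊥-elim (w≢u w≡u)
  ...   | no _ = coeff-removeWord-self u f

  coeff-removeWord-other : ∀ u w f → u ≢ w → coeff w (removeWord u f) ≈ coeff w f
  coeff-removeWord-other u w [] _ = K.refl
  coeff-removeWord-other u w ((x , v) ∷ f) u≢w with v ≟ᵂ u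
  coeff-removeWord-other u w ((x , .u) ∷ f) u≢w | yes refl with u ≟ᵂ w
  ... | yes u≡w = ⊥-elim (u≢w u≡w)
  ... | no _ = coeff-removeWord-other u w f u≢w
  coeff-removeWord-other u w ((x , v) ∷ f) u≢w | no _ with v ≟ᵂ w
  ... | yes _ = K.+-congˡ (coeff-removeWord-other u w f u≢w)
  ... | no _ = coeff-removeWord-other u w f u≢w

  length-removeWord : ∀ u f → length (removeWord u f) ≤ length f
  length-removeWord u [] = z≤n
  length-removeWord u ((x , w) ∷ f) with w ≟ᵂ u
  ... | yes _ = ℕP.m≤n⇒m≤1+n (length-removeWord u f)
  ... | no _ = s≤s (length-removeWord u f)

  length-removeWord-∷ : ∀ u x f → length (removeWord u ((x , u) ∷ f)) ≤ length f
  length-removeWord-∷ u x f with u ≟ᵂ u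
  ... | yes _ = length-removeWord u f
  ... | no u≢u = ⊥-elim (u≢u refl)

  removeWord-cong : ∀ u f g → f ≋ g → removeWord u f ≋ removeWord u g
  removeWord-cong u f g f≋g w with u ≟ᵂ w
  ... | yes refl = K.trans (coeff-removeWord-self u f) (K.sym (coeff-removeWord-self u g))
  ... | no u≢w = K.trans (coeff-removeWord-other u w f u≢w) (K.trans (f≋g w) (K.sym (coeff-removeWord-other u w g u≢w)))

  classCoeff-≋[] : ∀ V g → g ≋ [] → classCoeff V g ≈ 0#
  classCoeff-≋[] V g = go (length g) g ℕP.≤-refl
    where
    go : ∀ n g → length g ≤ n → g ≋ [] → classCoeff V g ≈ 0#
    go _ [] _ _ = K.refl
    go (suc n) ((x , u) ∷ g) g≤1+n g≋[] = begin
      classCoeff V ((x , u) ∷ g)                                     ≈⟨ classCoeff-removeWord V u ((x , u) ∷ g) ⟩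
      inClass V u (coeff u ((x , u) ∷ g)) +ᴷ classCoeff V (removeWord u ((x , u) ∷ g))
        ≈⟨ K.+-cong (K.trans (inClass-cong V u (g≋[] u)) (inClass-0# V u))
                    (go n (removeWord u ((x , u) ∷ g)) (ℕP.≤-trans (length-removeWord-∷ u x g) (ℕP.≤-pred g≤1+n))
                       (removeWord-cong u ((x , u) ∷ g) [] g≋[])) ⟩
      0# +ᴷ 0#                                                       ≈⟨ K.+-identityʳ 0# ⟩
      0#                                                             ∎

  classCoeff-cong : ∀ V f g → f ≋ g → classCoeff V f ≈ classCoeff V g
  classCoeff-cong V f g = go (length f) f g ℕP.≤-refl
    where
    go : ∀ n f g → length f ≤ n → f ≋ g → classCoeff V f ≈ classCoeff V g
    go _ [] g _ []≋g = K.sym (classCoeff-≋[] V g (λ w → K.sym ([]≋g w)))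
    go (suc n) ((x , u) ∷ f) g f≤1+n f≋g = begin
      classCoeff V ((x , u) ∷ f)                                 ≈⟨ classCoeff-removeWord V u ((x , u) ∷ f) ⟩
      inClass V u (coeff u ((x , u) ∷ f)) +ᴷ classCoeff V (removeWord u ((x , u) ∷ f))
        ≈⟨ K.+-cong (inClass-cong V u (f≋g u))
                    (go n (removeWord u ((x , u) ∷ f)) (removeWord u g)
                       (ℕP.≤-trans (length-removeWord-∷ u x f) (ℕP.≤-pred f≤1+n)) (removeWord-cong u ((x , u) ∷ f) g f≋g)) ⟩
      inClass V u (coeff u g) +ᴷ classCoeff V (removeWord u g)   ≈⟨ classCoeff-removeWord V u g ⟨
      classCoeff V g                                             ∎

  classCoeff-expand : ∀ V t → ValidTerm t → classCoeff V (expand t) ≈ 0#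
  classCoeff-expand V (x , A , F , G , B) (_ , balF , _ , balG)
    with nf (A ++ F ++ G ++ B) ≟ᵂ V | nf (A ++ G ++ F ++ B) ≟ᵂ V
  ... | yes _ | yes _ = K.trans (K.+-congˡ (K.+-identityʳ _)) (K.-‿inverseʳ x)
  ... | no _ | no _ = K.trans (K.+-identityˡ _) (K.+-identityʳ 0#)
  ... | yes FG≡V | no GF≢V = ⊥-elim (GF≢V (trans (sym (nf-swap A F G B balF balG)) FG≡V))
  ... | no FG≢V | yes GF≡V = ⊥-elim (FG≢V (trans (nf-swap A F G B balF balG) GF≡V))

  classCoeff-J : ∀ V ts → All ValidTerm ts → classCoeff V (concatMap expand ts) ≈ 0#
  classCoeff-J V [] [] = K.refl
  classCoeff-J V (t ∷ ts) (valid-t ∷ valid-ts) = begin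
    classCoeff V (expand t ++ concatMap expand ts)
      ≈⟨ classCoeff-++ V (expand t) (concatMap expand ts) ⟩
    classCoeff V (expand t) +ᴷ classCoeff V (concatMap expand ts)
      ≈⟨ K.+-cong (classCoeff-expand V t valid-t) (classCoeff-J V ts valid-ts) ⟩
    0# +ᴷ 0#
      ≈⟨ K.+-identityʳ 0# ⟩
    0# ∎

  ∼⇒nf≡ : ∀ X W → X ∼ W → nf X ≡ nf W
  ∼⇒nf≡ X W (ts , valid-ts , X-W≋ts) with nf W ≟ᵂ nf X
  ... | yes W≡X = sym W≡X
  ... | no W≢X = ⊥-elim (K.1≉0 (begin
    1#                                     ≈⟨ one-in-class ⟨
    classCoeff (nf X) (diff X W)           ≈⟨ classCoeff-cong (nf X) (diff X W) (concatMap expand ts) X-W≋ts ⟩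
    classCoeff (nf X) (concatMap expand ts) ≈⟨ classCoeff-J (nf X) ts valid-ts ⟩
    0#                                     ∎))
    where
    one-in-class : classCoeff (nf X) (diff X W) ≈ 1#
    one-in-class with nf X ≟ᵂ nf X | nf W ≟ᵂ nf X
    ... | yes _ | no _ = K.trans (K.+-congˡ (K.+-identityʳ 0#)) (K.+-identityʳ 1#)
    ... | no X≢X | _ = ⊥-elim (X≢X refl)
    ... | _ | yes W≡X = ⊥-elim (W≢X W≡X)

proposition6p6 : {c ℓ : Level} (K : Field c ℓ) → let open FreeAlgebra K in
    (W : Word) → Balanced W →
    Σ Word λ V → V ∼ W × Reduced V
      × (∀ V′ → V′ ∼ W → Reduced V′ → V′ ≡ V)
      × (∀ X → X ∼ W → V ≤ᵃ X)
proposition6p6 K W _ =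
  nf W , normalise-∼ K (suc (binary W)) W , nf-reduced W ,
  (λ V′ V′∼W reduced → trans (sym (reduced⇒nf≡ V′ reduced)) (∼⇒nf≡ K V′ W V′∼W)) ,
  (λ X X∼W → subst (_≤ᵃ X) (∼⇒nf≡ K X W X∼W) (nf-≤ᵃ X))
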